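{- Let $f:\{0,1\}^n\to\{0,1\}$ be monotone. Then for every $x^\star\in\{0,1\}^n$, every minimal certificate $S$ for $f$'s value at $x^\star$ satisfies $|S|\le\mathrm{Cert}(f)$.
   Context: $f$ is monotone if $f(x)\le f(x')$ whenever $x\preceq x'$ coordinatewise. A certificate for $f$'s value at $x^\star$ is a set $S\subseteq[n]$ such that $f(y)=f(x^\star)$ for all $y$ with $y_i=x^\star_i$ for all $i\in S$. A certificate $S$ is minimal if no proper subset $S'\subsetneq S$ is a certificate for $f$'s value at $x^\star$. $\mathrm{Cert}(f,x)$ is the minimum size of a certificate for $f$'s value at $x$, and $\mathrm{Cert}(f)=\max_x\mathrm{Cert}(f,x)$. -}

module Defs where

open import Data.Bool using (Bool; true; false; _≤_; _∧_; _∨_; not; if_then_else_)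
open import Data.Nat using (ℕ; zero; suc; _⊔_; _⊓_)
open import Data.Fin using (Fin)
open import Data.Fin.Subset using (Subset; _∈_; _⊂_; ∣_∣)
open import Data.Vec using (Vec; []; _∷_; lookup)
open import Data.List using (List; []; _∷_; map; _++_; filter; foldr; concatMap)
open import Data.Product using (_×_)
open import Data.Empty using (⊥)
open import Relation.Binary.PropositionalEquality using (_≡_)
open import Relation.Nullary using (¬_)

Point : ℕ → Set
Point n = Vec Bool n

BoolFun : ℕ → Set
BoolFun n = Point n → Bool

Monotone : ∀ {n} → BoolFun n → Set
Monotone {n} f = ∀ (x x' : Point n) → (∀ i → lookup x i ≤ lookup x' i) → f x ≤ f x'

IsCertificate : ∀ {n} → BoolFun n → Point n → Subset n → Set
IsCertificate {n} f x S =
  ∀ (y : Point n) → (∀ i → i ∈ S → lookup y i ≡ lookup x i) → f y ≡ f x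

IsMinimalCertificate : ∀ {n} → BoolFun n → Point n → Subset n → Set
IsMinimalCertificate f x S =
  IsCertificate f x S × (∀ S' → S' ⊂ S → ¬ IsCertificate f x S')

allVecs : ∀ n → List (Vec Bool n)
allVecs zero    = [] ∷ []
allVecs (suc n) = map (false ∷_) (allVecs n) ++ map (true ∷_) (allVecs n)

_==_ : Bool → Bool → Bool
true  == b = b
false == b = not b

agreeOn : ∀ {n} → Subset n → Point n → Point n → Bool
agreeOn []           []       []       = true
agreeOn (s ∷ S) (y ∷ ys) (x ∷ xs) = ((not s) ∨ (y == x)) ∧ agreeOn S ys xs

isCert? : ∀ {n} → BoolFun n → Point n → Subset n → Bool
isCert? {n} f x S =
  foldr (λ y b → ((not (agreeOn S y x)) ∨ (f y == f x)) ∧ b) true (allVecs n)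

-- Minimum over a list, with a default upper bound (n, the size of [n],
-- which is always a certificate size since S = [n] is a certificate).
minList : ℕ → List ℕ → ℕ
minList d = foldr _⊓_ d

maxList : List ℕ → ℕ
maxList = foldr _⊔_ 0

CertAt : ∀ {n} → BoolFun n → Point n → ℕ
CertAt {n} f x =
  minList n (map ∣_∣ (filter (λ S → isCert? f x S ≡? true) (allVecs n)))
  where
    open import Data.Bool.Properties using () renaming (_≟_ to _≡?_)

Cert : ∀ {n} → BoolFun n → ℕ
Cert {n} f = maxList (map (CertAt f) (allVecs n))

-- Let b = f x and let z agree with x on S and equal not b off S. If T certifies
-- f at z, then T ∩ S certifies f at x: a point y agreeing with x on T ∩ S is
-- patched on T to a point y′ agreeing with z, so f y′ = f z = b; and y′ differs
-- from y only in coordinates set to not b, so monotonicity forces f y = b.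
-- Minimality of S then gives S ⊆ T, hence |S| ≤ Cert(f, z) ≤ Cert(f).
{-# OPTIONS --safe #-}
module Submission where

open import Defs
open import Data.Nat using (_≤_)
open import Data.Fin.Subset using (Subset; ∣_∣)

open import Data.Nat using (ℕ; suc)
open import Data.Nat.Properties using (≤-trans; ≤-reflexive; ⊓-glb; m≤n⇒m≤n⊔o; m≤n⇒m≤o⊔n)
open import Data.Bool as Bool using (Bool; true; false; not; _∧_; _∨_; if_then_else_)
open import Data.Bool.Properties using (≤-minimum; ≤-maximum; ≤-antisym) renaming (_≟_ to _≟ᵇ_; ≤-reflexive to ≤ᵇ-reflexive)
open import Data.Fin using (Fin)
open import Data.Fin.Subset using (_∈_; _⊆_; _∩_; ⊤)
open import Data.Fin.Subset.Properties using (_∈?_; ∈⊤; ∣⊤∣≡n; p⊆q⇒∣p∣≤∣q∣; p∩q⊆q; x∈p∩q⁺; x∈p∩q⁻)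
open import Data.Vec using (Vec; []; _∷_; lookup; tabulate; replicate; here; there)
open import Data.Vec.Properties using (lookup∘tabulate; tabulate∘lookup; tabulate-cong; lookup-replicate; []=⇒lookup; lookup⇒[]=)
open import Data.List using (List; []; _∷_; map; foldr)
open import Data.List.Properties using (foldr-preservesᵇ; foldr-preservesᵒ)
open import Data.List.Membership.Propositional renaming (_∈_ to _∈ₗ_)
open import Data.List.Membership.Propositional.Properties using (∈-map⁺; ∈-++⁺ˡ; ∈-++⁺ʳ)
open import Data.List.Relation.Unary.All as All using (All)
open import Data.List.Relation.Unary.All.Properties using (map⁺; all-filter)
open import Data.List.Relation.Unary.Any as Any using (here)
open import Data.Product using (_×_; _,_; proj₁)
open import Data.Sum using (_⊎_; inj₁; inj₂; [_,_])
open import Function using (_∘_)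
open import Relation.Nullary using (yes; no; contradiction)
open import Relation.Binary.PropositionalEquality using (_≡_; refl; sym; trans; cong; subst)

private
  variable
    n : ℕ
    f : BoolFun n
    x : Point n
    S T : Subset n

allVecs-complete : (v : Vec Bool n) → v ∈ₗ allVecs n
allVecs-complete []                 = here refl
allVecs-complete (false ∷ v)        = ∈-++⁺ˡ (∈-map⁺ (false ∷_) (allVecs-complete v))
allVecs-complete {suc n} (true ∷ v) = ∈-++⁺ʳ (map (false ∷_) (allVecs n)) (∈-map⁺ (true ∷_) (allVecs-complete v))

==-sound : ∀ a b → (a == b) ≡ true → a ≡ b
==-sound true  true  _ = refl
==-sound false false _ = refl

==-refl : ∀ b → (b == b) ≡ true
==-refl true  = refl
==-refl false = refl

foldr-∧-true : {A : Set} (g : A → Bool) (xs : List A) →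
               foldr (λ y b → g y ∧ b) true xs ≡ true → All (λ y → g y ≡ true) xs
foldr-∧-true g []       _ = All.[]
foldr-∧-true g (y ∷ ys) eq with g y in gy
... | true = gy All.∷ foldr-∧-true g ys eq

agreeOn-complete : (T : Subset n) (y x : Point n) →
                   (∀ i → i ∈ T → lookup y i ≡ lookup x i) → agreeOn T y x ≡ true
agreeOn-complete []          []      []      _     = refl
agreeOn-complete (false ∷ T) (_ ∷ y) (_ ∷ x) y≈x = agreeOn-complete T y x (λ i → y≈x (Fin.suc i) ∘ there)
agreeOn-complete (true ∷ T)  (a ∷ y) (b ∷ x) y≈x
  rewrite y≈x Fin.zero here | ==-refl b       = agreeOn-complete T y x (λ i → y≈x (Fin.suc i) ∘ there)

isCert?-sound : (f : BoolFun n) (x : Point n) (T : Subset n) →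
                isCert? f x T ≡ true → IsCertificate f x T
isCert?-sound {n} f x T checked y y≈x =
  ==-sound (f y) (f x) (implication (agreeOn-complete T y x y≈x) (All.lookup passes (allVecs-complete y)))
  where
  passes : All (λ y → (not (agreeOn T y x) ∨ (f y == f x)) ≡ true) (allVecs n)
  passes = foldr-∧-true _ (allVecs n) checked
  implication : ∀ {a c} → a ≡ true → (not a ∨ c) ≡ true → c ≡ true
  implication refl c≡true = c≡true

⊤-isCertificate : IsCertificate f x ⊤
⊤-isCertificate {f = f} {x} y y≈x = cong f y≡x
  where
  y≡x : y ≡ x
  y≡x = trans (sym (tabulate∘lookup y)) (trans (tabulate-cong (λ i → y≈x i ∈⊤)) (tabulate∘lookup x))

CertAt-greatest : ∀ {k} → (∀ T → IsCertificate f x T → k ≤ ∣ T ∣) → k ≤ CertAt f x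
CertAt-greatest {n} {f} {x} {k} lower =
  foldr-preservesᵇ {P = k ≤_} ⊓-glb (subst (_ ≤_) (∣⊤∣≡n n) (lower ⊤ ⊤-isCertificate))
    (map⁺ (All.map (λ {T} → lower T ∘ isCert?-sound f x T)
                   (all-filter (λ T → isCert? f x T ≟ᵇ true) (allVecs n))))

CertAt≤Cert : (f : BoolFun n) (x : Point n) → CertAt f x ≤ Cert f
CertAt≤Cert {n} f x =
  foldr-preservesᵒ {P = CertAt f x ≤_} (λ a b → [ m≤n⇒m≤n⊔o b , m≤n⇒m≤o⊔n a ])
    0 (map (CertAt f) (allVecs n)) (inj₂ (Any.map ≤-reflexive (∈-map⁺ (CertAt f) (allVecs-complete x))))

ResetTo : Bool → Point n → Point n → Set
ResetTo c y y′ = ∀ i → lookup y′ i ≡ lookup y i ⊎ lookup y′ i ≡ c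

resetTo-false⇒≤ : ∀ {y y′ : Point n} → ResetTo false y y′ → ∀ i → lookup y′ i Bool.≤ lookup y i
resetTo-false⇒≤ reset i with reset i
... | inj₁ unchanged  = ≤ᵇ-reflexive unchanged
... | inj₂ y′ᵢ≡false = subst (Bool._≤ _) (sym y′ᵢ≡false) (≤-minimum _)

resetTo-true⇒≥ : ∀ {y y′ : Point n} → ResetTo true y y′ → ∀ i → lookup y i Bool.≤ lookup y′ i
resetTo-true⇒≥ reset i with reset i
... | inj₁ unchanged  = ≤ᵇ-reflexive (sym unchanged)
... | inj₂ y′ᵢ≡true  = subst (_ Bool.≤_) (sym y′ᵢ≡true) (≤-maximum _)

monotone-resetTo : Monotone f → ∀ b {y y′} → ResetTo (not b) y y′ → f y′ ≡ b → f y ≡ b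
monotone-resetTo {f = f} monotone true  {y} {y′} reset fy′≡true =
  ≤-antisym (≤-maximum (f y)) (subst (Bool._≤ f y) fy′≡true (monotone y′ y (resetTo-false⇒≤ {y = y} {y′} reset)))
monotone-resetTo {f = f} monotone false {y} {y′} reset fy′≡false =
  ≤-antisym (subst (f y Bool.≤_) fy′≡false (monotone y y′ (resetTo-true⇒≥ {y = y} {y′} reset))) (≤-minimum (f y))

patch : Subset n → Point n → Point n → Point n
patch T u v = tabulate λ i → if lookup T i then lookup u i else lookup v i

patch-agrees : (T : Subset n) (u v : Point n) → ∀ i → i ∈ T → lookup (patch T u v) i ≡ lookup u i
patch-agrees T u v i i∈T
  rewrite lookup∘tabulate (λ j → if lookup T j then lookup u j else lookup v j) i | []=⇒lookup i∈T = refl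

lookup-patch : (T : Subset n) (u v : Point n) (i : Fin n) →
               (i ∈ T × lookup (patch T u v) i ≡ lookup u i) ⊎ lookup (patch T u v) i ≡ lookup v i
lookup-patch T u v i rewrite lookup∘tabulate (λ j → if lookup T j then lookup u j else lookup v j) i
  with lookup T i in i∈T
... | true  = inj₁ (lookup⇒[]= i T i∈T , refl)
... | false = inj₂ refl

certificate-∩ : Monotone f → IsCertificate f x S →
                IsCertificate f (patch S x (replicate n (not (f x)))) T → IsCertificate f x (T ∩ S)
certificate-∩ {n} {f} {x} {S} {T} monotone S-cert T-cert y y≈x =
  monotone-resetTo monotone (f x) reset fy′≡fx
  where
  z y′ : Point n
  z  = patch S x (replicate n (not (f x)))
  y′ = patch T z y

  fy′≡fx : f y′ ≡ f x
  fy′≡fx = trans (T-cert y′ (patch-agrees T z y)) (S-cert z (patch-agrees S x (replicate n (not (f x)))))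

  reset : ResetTo (not (f x)) y y′
  reset i with lookup-patch T z y i
  ... | inj₂ y′ᵢ≡yᵢ = inj₁ y′ᵢ≡yᵢ
  ... | inj₁ (i∈T , y′ᵢ≡zᵢ) with lookup-patch S x (replicate n (not (f x))) i
  ...   | inj₁ (i∈S , zᵢ≡xᵢ) = inj₁ (trans y′ᵢ≡zᵢ (trans zᵢ≡xᵢ (sym (y≈x i (x∈p∩q⁺ (i∈T , i∈S))))))
  ...   | inj₂ zᵢ≡c          = inj₂ (trans y′ᵢ≡zᵢ (trans zᵢ≡c (lookup-replicate i (not (f x)))))

minimal-certificate-⊆ : IsMinimalCertificate f x S → IsCertificate f x (T ∩ S) → S ⊆ T
minimal-certificate-⊆ {S = S} {T} (_ , minimal) T∩S-cert {i} i∈S with i ∈? T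
... | yes i∈T = i∈T
... | no  i∉T = contradiction T∩S-cert (minimal (T ∩ S) (p∩q⊆q T S , i , i∈S , i∉T ∘ proj₁ ∘ x∈p∩q⁻ T S))

fact2p1 : ∀ {n} (f : BoolFun n) → Monotone f →
          ∀ (xstar : Point n) (S : Subset n) →
          IsMinimalCertificate f xstar S → ∣ S ∣ ≤ Cert f
fact2p1 {n} f monotone xstar S S-minimal@(S-cert , _) =
  ≤-trans (CertAt-greatest ∣S∣≤∣certificate∣) (CertAt≤Cert f z)
  where
  z : Point n
  z = patch S xstar (replicate n (not (f xstar)))

  ∣S∣≤∣certificate∣ : ∀ T → IsCertificate f z T → ∣ S ∣ ≤ ∣ T ∣
  ∣S∣≤∣certificate∣ T T-cert =
    p⊆q⇒∣p∣≤∣q∣ (minimal-certificate-⊆ S-minimal (certificate-∩ monotone S-cert T-cert))
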